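{- Let $\mathbf{M}=\langle\mathbf{H},\square,\Diamond\rangle$ be a modal Heyting algebra. Then $\mathbf{N}(\mathbf{M})=\langle R(\mathbf{H}),\blacksquare,\Diamond_N\rangle$ is a modal Nelson lattice, where $R(\mathbf{H})=\{(x,y)\in H\times H: x\wedge y=\bot\}$ carries the twist operations $(x,y)\vee(s,t)=(x\vee s,y\wedge t)$, $(x,y)\wedge(s,t)=(x\wedge s,y\vee t)$, $(x,y)*(s,t)=(x\wedge s,(x\rightharpoonup t)\wedge(s\rightharpoonup y))$, $(x,y)\Rightarrow(s,t)=((x\rightharpoonup s)\wedge(t\rightharpoonup y),x\wedge t)$, $\top=(\top,\bot)$, $\bot=(\bot,\top)$, and the modal operators are $\blacksquare(x,y)=(\square x,\Diamond y)$ and $\Diamond_N(x,y)=(\Diamond x,\square y)$.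
   Context: A modal Heyting algebra is $\langle\mathbf{H},\square,\Diamond\rangle$ with $\mathbf{H}$ a Heyting algebra (implication $\rightharpoonup$, $-a=a\rightharpoonup\bot$) and unary $\square,\Diamond$ satisfying $\square a\wedge\Diamond(-a\wedge b)=\bot$. A Nelson lattice is an involutive residuated lattice $\langle A,\wedge,\vee,*,\Rightarrow,\top,\bot\rangle$ ($\sim a=a\Rightarrow\bot$, $\sim\sim a=a$, $a^2=a*a$) satisfying $((a^2\Rightarrow b)\wedge((\sim b)^2\Rightarrow\sim a))\Rightarrow(a\Rightarrow b)=\top$. A modal Nelson lattice is $\langle\mathbf{A},\blacksquare,\Diamond_N\rangle$ (here $\Diamond_N$ denotes the Nelson-level diamond, written as a black lozenge in the paper) with $\mathbf{A}$ a Nelson lattice such that for all $a,b$: $\Diamond_N a=\sim\blacksquare\sim a$; if $a^2=b^2$ then $(\blacksquare a)^2=(\blacksquare b)^2$ and $(\Diamond_N a)^2=(\Diamond_N b)^2$; and $(\blacksquare a\wedge\Diamond_N(\sim a^2\wedge b))^2=\bot$. -}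

module Defs where

open import Level using (Level; _⊔_; suc)
open import Data.Product using (_×_; _,_; proj₁; proj₂)
open import Function.Bundles using (_⇔_)
open import Algebra.Core using (Op₁; Op₂)
open import Relation.Binary.Core using (Rel)
open import Relation.Binary.Structures using (IsEquivalence)
open import Algebra.Structures using (IsCommutativeMonoid)
open import Algebra.Lattice.Structures using (IsLattice)
open import Relation.Binary.Lattice using (HeytingAlgebra)
import Relation.Binary.Lattice.Properties.HeytingAlgebra as HAProps
import Relation.Binary.Lattice.Properties.MeetSemilattice as MSProps

-- Modal Heyting algebras  ⟨H, □, ◇⟩ with  □a ∧ ◇(-a ∧ b) = ⊥,
-- where -a = a ⇨ ⊥.  Since the carrier is a setoid, □ and ◇ are
-- required to respect the equality (automatic for genuine equality).

record ModalHeytingAlgebra (c ℓ₁ ℓ₂ : Level) : Set (suc (c ⊔ ℓ₁ ⊔ ℓ₂)) where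
  field
    heyting : HeytingAlgebra c ℓ₁ ℓ₂
  open HeytingAlgebra heyting public
  -_ : Op₁ Carrier
  - a = a ⇨ ⊥
  field
    □ : Op₁ Carrier
    ◇ : Op₁ Carrier
    □-cong : ∀ {a b} → a ≈ b → □ a ≈ □ b
    ◇-cong : ∀ {a b} → a ≈ b → ◇ a ≈ ◇ b
    modal-axiom : ∀ a b → □ a ∧ ◇ ((- a) ∧ b) ≈ ⊥

-- Nelson lattices.  "Residuated lattice" is read (as in the Nelson
-- lattice literature) as a bounded, commutative, integral residuated
-- lattice ⟨A, ∧, ∨, *, ⇒, ⊤, ⊥⟩: (A,∧,∨) a lattice, (A,*,⊤) a
-- commutative monoid, ⊤ the top and ⊥ the bottom of the lattice, and
-- a * b ≤ c iff a ≤ b ⇒ c, where x ≤ y means x ∧ y = x.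


record IsNelsonLattice {a ℓ} {A : Set a} (_≈_ : Rel A ℓ)
       (_∨_ _∧_ _*_ _⇒_ : Op₂ A) (⊤ ⊥ : A) : Set (a ⊔ ℓ) where
  _≤_ : Rel A ℓ
  x ≤ y = (x ∧ y) ≈ x
  ∼_ : Op₁ A
  ∼ x = x ⇒ ⊥
  _² : Op₁ A
  x ² = x * x
  field
    isLattice           : IsLattice _≈_ _∨_ _∧_
    *-isCommutativeMonoid : IsCommutativeMonoid _≈_ _*_ ⊤
    ⇒-cong              : ∀ {x y u v} → x ≈ y → u ≈ v → (x ⇒ u) ≈ (y ⇒ v)
    top                 : ∀ x → x ≤ ⊤
    bottom              : ∀ x → ⊥ ≤ x
    residuation         : ∀ x y z → ((x * y) ≤ z) ⇔ (x ≤ (y ⇒ z))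
    involutive          : ∀ x → (∼ (∼ x)) ≈ x
    nelson              : ∀ x y →
      ((((x ²) ⇒ y) ∧ (((∼ y) ²) ⇒ (∼ x))) ⇒ (x ⇒ y)) ≈ ⊤

record IsModalNelsonLattice {a ℓ} {A : Set a} (_≈_ : Rel A ℓ)
       (_∨_ _∧_ _*_ _⇒_ : Op₂ A) (⊤ ⊥ : A) (■ ◆ : Op₁ A) : Set (a ⊔ ℓ) where
  field
    isNelsonLattice : IsNelsonLattice _≈_ _∨_ _∧_ _*_ _⇒_ ⊤ ⊥
  open IsNelsonLattice isNelsonLattice public
  field
    ■-cong   : ∀ {x y} → x ≈ y → ■ x ≈ ■ y
    ◆-cong   : ∀ {x y} → x ≈ y → ◆ x ≈ ◆ y
    ◆-def    : ∀ x → ◆ x ≈ (∼ (■ (∼ x)))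
    ■-sq     : ∀ x y → (x ²) ≈ (y ²) → ((■ x) ²) ≈ ((■ y) ²)
    ◆-sq     : ∀ x y → (x ²) ≈ (y ²) → ((◆ x) ²) ≈ ((◆ y) ²)
    modal-⊥  : ∀ x y → ((■ x ∧ ◆ ((∼ (x ²)) ∧ y)) ²) ≈ ⊥

module Twist {c ℓ₁ ℓ₂} (M : ModalHeytingAlgebra c ℓ₁ ℓ₂) where
  open ModalHeytingAlgebra M
  open HAProps heyting using (⇨-applyˡ; ⇨-applyʳ; ∧-distribˡ-∨-≤; swap-transpose-⇨)
  open MSProps meetSemilattice using (∧-monotonic)

  record R : Set (c ⊔ ℓ₁) where
    constructor ⟨_,_∣_⟩
    field
      fst : Carrier
      snd : Carrier
      disjoint : fst ∧ snd ≈ ⊥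
  open R public

  _≈R_ : Rel R ℓ₁
  p ≈R q = (fst p ≈ fst q) × (snd p ≈ snd q)

  private
    ≤⊥ : ∀ {u} → u ≤ ⊥ → u ≈ ⊥
    ≤⊥ p = antisym p (minimum _)

    ≈⊥ : ∀ {u} → u ≈ ⊥ → u ≤ ⊥
    ≈⊥ p = reflexive p

    tr = trans

  ∨R : Op₂ R
  ∨R ⟨ x , y ∣ p ⟩ ⟨ s , t ∣ q ⟩ = ⟨ x ∨ s , y ∧ t ∣ ≤⊥ pf ⟩
    where
    pf : (x ∨ s) ∧ (y ∧ t) ≤ ⊥
    pf = tr (∧-greatest (x∧y≤y _ _) (x∧y≤x _ _))
         (tr (∧-distribˡ-∨-≤ (y ∧ t) x s)
           (∨-least
             (tr (∧-greatest (x∧y≤y _ _) (tr (x∧y≤x _ _) (x∧y≤x _ _))) (≈⊥ p))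
             (tr (∧-greatest (x∧y≤y _ _) (tr (x∧y≤x _ _) (x∧y≤y _ _))) (≈⊥ q))))

  ∧R : Op₂ R
  ∧R ⟨ x , y ∣ p ⟩ ⟨ s , t ∣ q ⟩ = ⟨ x ∧ s , y ∨ t ∣ ≤⊥ pf ⟩
    where
    pf : (x ∧ s) ∧ (y ∨ t) ≤ ⊥
    pf = tr (∧-distribˡ-∨-≤ (x ∧ s) y t)
           (∨-least
             (tr (∧-monotonic (x∧y≤x _ _) refl) (≈⊥ p))
             (tr (∧-monotonic (x∧y≤y _ _) refl) (≈⊥ q)))

  *R : Op₂ R
  *R ⟨ x , y ∣ p ⟩ ⟨ s , t ∣ q ⟩ =
    ⟨ x ∧ s , (x ⇨ t) ∧ (s ⇨ y) ∣ ≤⊥ pf ⟩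
    where
    pf : (x ∧ s) ∧ ((x ⇨ t) ∧ (s ⇨ y)) ≤ ⊥
    pf = tr (∧-greatest (tr (x∧y≤x _ _) (x∧y≤y _ _))
               (tr (∧-monotonic refl (x∧y≤x _ _)) (⇨-applyʳ (x∧y≤x _ _))))
            (≈⊥ q)

  ⇒R : Op₂ R
  ⇒R ⟨ x , y ∣ p ⟩ ⟨ s , t ∣ q ⟩ =
    ⟨ (x ⇨ s) ∧ (t ⇨ y) , x ∧ t ∣ ≤⊥ pf ⟩
    where
    pf : ((x ⇨ s) ∧ (t ⇨ y)) ∧ (x ∧ t) ≤ ⊥
    pf = tr (∧-greatest (tr (∧-monotonic (x∧y≤x _ _) refl) (⇨-applyˡ (x∧y≤x _ _)))
               (tr (x∧y≤y _ _) (x∧y≤y _ _)))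
            (≈⊥ q)

  ⊤R : R
  ⊤R = ⟨ ⊤ , ⊥ ∣ ≤⊥ (x∧y≤y _ _) ⟩

  ⊥R : R
  ⊥R = ⟨ ⊥ , ⊤ ∣ ≤⊥ (x∧y≤x _ _) ⟩

  private
    absorb : ∀ {u v} → u ∧ v ≈ ⊥ → v ≈ (- u) ∧ v
    absorb {u} {v} e =
      antisym (∧-greatest (swap-transpose-⇨ (≈⊥ e))
                          refl)
              (x∧y≤y _ _)

    comm⊥ : ∀ {u v} → u ∧ v ≈ ⊥ → v ∧ u ≈ ⊥
    comm⊥ e = ≤⊥ (tr (∧-greatest (x∧y≤y _ _) (x∧y≤x _ _)) (≈⊥ e))

  ■R : Op₁ R
  ■R ⟨ x , y ∣ p ⟩ = ⟨ □ x , ◇ y ∣ ≤⊥ (tr (∧-monotonic refl (reflexive (◇-cong (absorb p))))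
                                          (≈⊥ (modal-axiom x y))) ⟩

  ◆R : Op₁ R
  ◆R ⟨ x , y ∣ p ⟩ = ⟨ ◇ x , □ y ∣ ≤⊥ pf ⟩
    where
    pf : ◇ x ∧ □ y ≤ ⊥
    pf = tr (∧-greatest (x∧y≤y _ _) (x∧y≤x _ _))
            (tr (∧-monotonic refl (reflexive (◇-cong (absorb (comm⊥ p)))))
                (≈⊥ (modal-axiom y x)))

{-# OPTIONS --safe #-}

-- R(H) is a sublattice of H × Hᵒᵖ, and each Nelson-lattice law of the twist
-- operations unfolds componentwise into a Heyting-algebra inequality.  Two
-- computations carry the modal part: ∼(x , y) ≈ (y , x) and (x , y)² ≈ (x , - x).
-- So a square is determined by its first component, on which ■ and ◆ act by □ and ◇;
-- and for a = (x , y), b = (s , t) the first component of ■a ∧ ◆(∼a² ∧ b) is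
-- □x ∧ ◇(- x ∧ s), which is ⊥ by the modal axiom of M.  A pair with first component ⊥ squares to ⊥ = (⊥ , ⊤).

module Submission where

open import Level using (Level)
open import Defs
open import Algebra.Core using (Op₁)
open import Algebra.Definitions using (LeftIdentity)
open import Algebra.Lattice.Structures using (IsLattice)
open import Algebra.Structures using (IsCommutativeMonoid)
open import Algebra.Structures.Biased using (isCommutativeMonoidʳ)
open import Data.Product using (_×_; _,_)
open import Data.Product.Relation.Binary.Pointwise.NonDependent using (×-isEquivalence)
open import Function.Bundles using (_⇔_; mk⇔; Equivalence)
open import Function.Construct.Composition using (_⇔-∘_)
open import Function.Construct.Symmetry using (⇔-sym)
open import Relation.Binary.Core using (Rel)
open import Relation.Binary.Lattice using (HeytingAlgebra)
open import Relation.Binary.Structures using (IsEquivalence)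
import Relation.Binary.Construct.On as On
import Relation.Binary.Lattice.Properties.HeytingAlgebra as HeytingAlgebraProperties
import Relation.Binary.Lattice.Properties.Lattice as LatticeProperties
import Relation.Binary.Lattice.Properties.MeetSemilattice as MeetSemilatticeProperties
import Relation.Binary.Reasoning.PartialOrder as ≤-Reasoning
import Relation.Binary.Reasoning.Setoid as ≈-Reasoning

module HeytingAlgebraLemmas {c ℓ₁ ℓ₂} (H : HeytingAlgebra c ℓ₁ ℓ₂) where
  open HeytingAlgebra H
  open HeytingAlgebraProperties H
  open MeetSemilatticeProperties meetSemilattice using (∧-comm; y≤x⇒x∧y≈y)

  x≤y⇒x∧y≈x : ∀ {x y} → x ≤ y → x ∧ y ≈ x
  x≤y⇒x∧y≈x x≤y = antisym (x∧y≤x _ _) (∧-greatest refl x≤y)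

  x∧y≈x⇒x≤y : ∀ {x y} → x ∧ y ≈ x → x ≤ y
  x∧y≈x⇒x≤y x∧y≈x = trans (reflexive (Eq.sym x∧y≈x)) (x∧y≤y _ _)

  y≤x⇒x∨y≈x : ∀ {x y} → y ≤ x → x ∨ y ≈ x
  y≤x⇒x∨y≈x y≤x = antisym (∨-least refl y≤x) (x≤x∨y _ _)

  x∨y≈x⇒y≤x : ∀ {x y} → x ∨ y ≈ x → y ≤ x
  x∨y≈x⇒y≤x x∨y≈x = trans (y≤x∨y _ _) (reflexive x∨y≈x)

  swap-transpose-∧ : ∀ {w x y} → w ≤ x ⇨ y → x ∧ w ≤ y
  swap-transpose-∧ w≤x⇨y = trans (reflexive (∧-comm _ _)) (transpose-∧ w≤x⇨y)

  ⇨-identityˡ : LeftIdentity _≈_ ⊤ _⇨_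
  ⇨-identityˡ x = antisym (trans (∧-greatest refl (maximum _)) ⇨-eval) y≤x⇨y

  x≤y⇒x⇨y≈⊤ : ∀ {x y} → x ≤ y → x ⇨ y ≈ ⊤
  x≤y⇒x⇨y≈⊤ x≤y = antisym (maximum _) (transpose-⇨ (trans (x∧y≤y _ _) x≤y))

  ⇨-exchange : ∀ {x y z} → x ⇨ y ⇨ z ≈ y ⇨ x ⇨ z
  ⇨-exchange = Eq.trans (Eq.sym ⇨-curry) (Eq.trans (⇨-cong (∧-comm _ _) Eq.refl) ⇨-curry)

  x∧y≈⊥⇒y≤¬x : ∀ {x y} → x ∧ y ≈ ⊥ → y ≤ ¬ x
  x∧y≈⊥⇒y≤¬x x∧y≈⊥ = swap-transpose-⇨ (reflexive x∧y≈⊥)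

  x∧y≈⊥⇒¬x∧y≈y : ∀ {x y} → x ∧ y ≈ ⊥ → ¬ x ∧ y ≈ y
  x∧y≈⊥⇒¬x∧y≈y x∧y≈⊥ = y≤x⇒x∧y≈y (x∧y≈⊥⇒y≤¬x x∧y≈⊥)

  x∧y≈⊥⇒x⇨y≈¬x : ∀ {x y} → x ∧ y ≈ ⊥ → x ⇨ y ≈ ¬ x
  x∧y≈⊥⇒x⇨y≈¬x x∧y≈⊥ =
    antisym (transpose-⇨ (trans (∧-greatest (x∧y≤y _ _) ⇨-eval) (reflexive x∧y≈⊥)))
            (⇨ʳ-covariant (minimum _))

module TwistProperties {c ℓ₁ ℓ₂} (M : ModalHeytingAlgebra c ℓ₁ ℓ₂) where
  open ModalHeytingAlgebra M
  open HeytingAlgebraProperties heyting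
    using (⇨-eval; ⇨-cong; ⇨-curry; ⇨-unit; ⇨-distribˡ-∧; swap-transpose-⇨)
  open MeetSemilatticeProperties meetSemilattice using (∧-idempotent; ∧-monotonic)
  open HeytingAlgebraLemmas heyting
  open Twist M

  private
    module H = IsLattice (LatticeProperties.isAlgLattice lattice)
    module Hᵒᵖ = IsLattice (LatticeProperties.isAlgLattice (LatticeProperties.∧-∨-lattice lattice))

  infix 4 _≤R_
  infix 30 _²R

  _≤R_ : Rel R ℓ₁
  p ≤R q = ∧R p q ≈R p

  ∼R : Op₁ R
  ∼R p = ⇒R p ⊥R

  _²R : Op₁ R
  p ²R = *R p p

  ≤R⇔ : ∀ p q → (p ≤R q) ⇔ (fst p ≤ fst q × snd q ≤ snd p)
  ≤R⇔ _ _ = mk⇔ (λ (e₁ , e₂) → x∧y≈x⇒x≤y e₁ , x∨y≈x⇒y≤x e₂)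
                (λ (h₁ , h₂) → x≤y⇒x∧y≈x h₁ , y≤x⇒x∨y≈x h₂)

  ≈R-isEquivalence : IsEquivalence _≈R_
  ≈R-isEquivalence =
    On.isEquivalence (λ p → fst p , snd p) (×-isEquivalence isEquivalence isEquivalence)

  ∨R-∧R-isLattice : IsLattice _≈R_ ∨R ∧R
  ∨R-∧R-isLattice = record
    { isEquivalence = ≈R-isEquivalence
    ; ∨-comm        = λ _ _ → H.∨-comm _ _ , Hᵒᵖ.∨-comm _ _
    ; ∨-assoc       = λ _ _ _ → H.∨-assoc _ _ _ , Hᵒᵖ.∨-assoc _ _ _
    ; ∨-cong        = λ (e₁ , e₂) (e₃ , e₄) → H.∨-cong e₁ e₃ , Hᵒᵖ.∨-cong e₂ e₄
    ; ∧-comm        = λ _ _ → H.∧-comm _ _ , Hᵒᵖ.∧-comm _ _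
    ; ∧-assoc       = λ _ _ _ → H.∧-assoc _ _ _ , Hᵒᵖ.∧-assoc _ _ _
    ; ∧-cong        = λ (e₁ , e₂) (e₃ , e₄) → H.∧-cong e₁ e₃ , Hᵒᵖ.∧-cong e₂ e₄
    ; absorptive    = (λ _ _ → H.∨-absorbs-∧ _ _ , Hᵒᵖ.∨-absorbs-∧ _ _)
                    , (λ _ _ → H.∧-absorbs-∨ _ _ , Hᵒᵖ.∧-absorbs-∨ _ _)
    }

  ∼R-fst : ∀ p → fst (∼R p) ≈ snd p
  ∼R-fst p = Eq.trans (H.∧-cong Eq.refl (⇨-identityˡ (snd p))) (x∧y≈⊥⇒¬x∧y≈y (disjoint p))

  ∼R-snd : ∀ p → snd (∼R p) ≈ fst p
  ∼R-snd p = x≤y⇒x∧y≈x (maximum (fst p))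

  ∼R-involutive : ∀ p → ∼R (∼R p) ≈R p
  ∼R-involutive p = Eq.trans (∼R-fst (∼R p)) (∼R-snd p) , Eq.trans (∼R-snd (∼R p)) (∼R-fst p)

  *R-comm : ∀ p q → *R p q ≈R *R q p
  *R-comm _ _ = H.∧-comm _ _ , H.∧-comm _ _

  -- p * ⊤ and ∼ p have the same components, in swapped order.
  *R-identityʳ : ∀ p → *R p ⊤R ≈R p
  *R-identityʳ p = ∼R-snd p , ∼R-fst p

  *R-assoc : ∀ p q r → *R (*R p q) r ≈R *R p (*R q r)
  *R-assoc ⟨ x , y ∣ _ ⟩ ⟨ s , t ∣ _ ⟩ ⟨ u , v ∣ _ ⟩ = H.∧-assoc x s u , (begin
    ((x ∧ s) ⇨ v) ∧ (u ⇨ ((x ⇨ t) ∧ (s ⇨ y)))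
      ≈⟨ H.∧-cong ⇨-curry (⇨-distribˡ-∧ _ _ _) ⟩
    (x ⇨ s ⇨ v) ∧ ((u ⇨ x ⇨ t) ∧ (u ⇨ s ⇨ y))
      ≈⟨ H.∧-cong Eq.refl (H.∧-cong ⇨-exchange ⇨-exchange) ⟩
    (x ⇨ s ⇨ v) ∧ ((x ⇨ u ⇨ t) ∧ (s ⇨ u ⇨ y))
      ≈⟨ Eq.sym (H.∧-assoc _ _ _) ⟩
    ((x ⇨ s ⇨ v) ∧ (x ⇨ u ⇨ t)) ∧ (s ⇨ u ⇨ y)
      ≈⟨ H.∧-cong (Eq.sym (⇨-distribˡ-∧ _ _ _)) (Eq.sym ⇨-curry) ⟩
    (x ⇨ ((s ⇨ v) ∧ (u ⇨ t))) ∧ ((s ∧ u) ⇨ y) ∎)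
    where open ≈-Reasoning setoid

  *R-isCommutativeMonoid : IsCommutativeMonoid _≈R_ *R ⊤R
  *R-isCommutativeMonoid = isCommutativeMonoidʳ record
    { isSemigroup = record
      { isMagma = record
        { isEquivalence = ≈R-isEquivalence
        ; ∙-cong        = λ (e₁ , e₂) (e₃ , e₄) →
                            H.∧-cong e₁ e₃ , H.∧-cong (⇨-cong e₁ e₄) (⇨-cong e₃ e₂)
        }
      ; assoc = *R-assoc
      }
    ; identityʳ = *R-identityʳ
    ; comm      = *R-comm
    }

  *R-⇒R-residuated : ∀ p q r → (*R p q ≤R r) ⇔ (p ≤R ⇒R q r)
  *R-⇒R-residuated p@(⟨ x , y ∣ _ ⟩) q@(⟨ s , t ∣ _ ⟩) r@(⟨ u , v ∣ _ ⟩) =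
    ⇔-sym (≤R⇔ p (⇒R q r)) ⇔-∘ (componentwise ⇔-∘ ≤R⇔ (*R p q) r)
    where
    componentwise : (x ∧ s ≤ u × v ≤ (x ⇨ t) ∧ (s ⇨ y)) ⇔ (x ≤ (s ⇨ u) ∧ (v ⇨ t) × s ∧ v ≤ y)
    componentwise = mk⇔
      (λ (h₁ , h₂) → ∧-greatest (transpose-⇨ h₁)
                                (transpose-⇨ (swap-transpose-∧ (trans h₂ (x∧y≤x _ _))))
                   , swap-transpose-∧ (trans h₂ (x∧y≤y _ _)))
      (λ (h₁ , h₂) → transpose-∧ (trans h₁ (x∧y≤x _ _))
                   , ∧-greatest (swap-transpose-⇨ (transpose-∧ (trans h₁ (x∧y≤y _ _))))
                                (swap-transpose-⇨ h₂))

  ²R-fst : ∀ p → fst (p ²R) ≈ fst p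
  ²R-fst p = ∧-idempotent (fst p)

  ²R-snd : ∀ p → snd (p ²R) ≈ - fst p
  ²R-snd p = Eq.trans (∧-idempotent _) (x∧y≈⊥⇒x⇨y≈¬x (disjoint p))

  ²R≈⇔fst≈ : ∀ p q → (p ²R ≈R q ²R) ⇔ (fst p ≈ fst q)
  ²R≈⇔fst≈ p q = mk⇔
    (λ (e , _) → Eq.trans (Eq.sym (²R-fst p)) (Eq.trans e (²R-fst q)))
    (λ e → Eq.trans (²R-fst p) (Eq.trans e (Eq.sym (²R-fst q)))
         , Eq.trans (²R-snd p) (Eq.trans (⇨-cong e Eq.refl) (Eq.sym (²R-snd q))))

  fst≈⊥⇒²R≈⊥R : ∀ p → fst p ≈ ⊥ → p ²R ≈R ⊥R
  fst≈⊥⇒²R≈⊥R p e = Eq.trans (²R-fst p) e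
                   , Eq.trans (²R-snd p) (Eq.trans (⇨-cong e Eq.refl) ⇨-unit)

  fst-²R⇒R : ∀ p q → fst (⇒R (p ²R) q) ≈ (fst p ⇨ fst q) ∧ (snd q ⇨ - fst p)
  fst-²R⇒R p q = H.∧-cong (⇨-cong (²R-fst p) Eq.refl) (⇨-cong Eq.refl (²R-snd p))

  ⇒R≈⊤R : ∀ p q → fst p ≤ fst q → snd q ≤ snd p → fst p ∧ snd q ≤ ⊥ → ⇒R p q ≈R ⊤R
  ⇒R≈⊤R _ _ h₁ h₂ h₃ = Eq.trans (H.∧-cong (x≤y⇒x⇨y≈⊤ h₁) (x≤y⇒x⇨y≈⊤ h₂)) (∧-idempotent ⊤)
                     , antisym h₃ (minimum _)

  nelson-law : ∀ a b → ⇒R (∧R (⇒R (a ²R) b) (⇒R ((∼R b) ²R) (∼R a))) (⇒R a b) ≈R ⊤R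
  nelson-law a@(⟨ x , y ∣ _ ⟩) b@(⟨ s , t ∣ _ ⟩) =
    ⇒R≈⊤R premise (⇒R a b) (∧-monotonic A≤x⇨s B≤t⇨y) x∧t≤sndA∨sndB disjoint-conclusion
    where
    premise : R
    premise = ∧R (⇒R (a ²R) b) (⇒R ((∼R b) ²R) (∼R a))

    A B : Carrier
    A = fst (⇒R (a ²R) b)
    B = fst (⇒R ((∼R b) ²R) (∼R a))

    A≤x⇨s : A ≤ x ⇨ s
    A≤x⇨s = trans (reflexive (fst-²R⇒R a b)) (x∧y≤x _ _)

    A≤t⇨-x : A ≤ t ⇨ - x
    A≤t⇨-x = trans (reflexive (fst-²R⇒R a b)) (x∧y≤y _ _)

    B≤t⇨y : B ≤ t ⇨ y
    B≤t⇨y = trans (reflexive (fst-²R⇒R (∼R b) (∼R a)))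
                  (trans (x∧y≤x _ _) (reflexive (⇨-cong (∼R-fst b) (∼R-fst a))))

    x∧t≤sndA∨sndB : x ∧ t ≤ snd premise
    x∧t≤sndA∨sndB = trans (∧-monotonic (∧-greatest refl refl) refl) (x≤x∨y _ _)

    disjoint-conclusion : (A ∧ B) ∧ (x ∧ t) ≤ ⊥
    disjoint-conclusion = begin
      (A ∧ B) ∧ (x ∧ t)   ≤⟨ ∧-greatest (∧-greatest (trans (x∧y≤x _ _) (trans (x∧y≤x _ _) A≤t⇨-x))
                                                    (trans (x∧y≤y _ _) (x∧y≤y _ _)))
                                        (trans (x∧y≤y _ _) (x∧y≤x _ _)) ⟩
      ((t ⇨ - x) ∧ t) ∧ x ≤⟨ ∧-monotonic ⇨-eval refl ⟩
      - x ∧ x             ≤⟨ ⇨-eval ⟩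
      ⊥                   ∎
      where open ≤-Reasoning poset

  twist-isNelsonLattice : IsNelsonLattice _≈R_ ∨R ∧R *R ⇒R ⊤R ⊥R
  twist-isNelsonLattice = record
    { isLattice             = ∨R-∧R-isLattice
    ; *-isCommutativeMonoid = *R-isCommutativeMonoid
    ; ⇒-cong                = λ (e₁ , e₂) (e₃ , e₄) →
                                H.∧-cong (⇨-cong e₁ e₃) (⇨-cong e₄ e₂) , H.∧-cong e₁ e₄
    ; top                   = λ p → Equivalence.from (≤R⇔ p ⊤R) (maximum _ , minimum _)
    ; bottom                = λ p → Equivalence.from (≤R⇔ ⊥R p) (minimum _ , maximum _)
    ; residuation           = *R-⇒R-residuated
    ; involutive            = ∼R-involutive
    ; nelson                = nelson-law
    }

  ◆R≈∼R■R∼R : ∀ p → ◆R p ≈R ∼R (■R (∼R p))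
  ◆R≈∼R■R∼R p = Eq.sym (Eq.trans (∼R-fst (■R (∼R p))) (◇-cong (∼R-snd p)))
              , Eq.sym (Eq.trans (∼R-snd (■R (∼R p))) (□-cong (∼R-fst p)))

  modal-⊥R : ∀ p q → (∧R (■R p) (◆R (∧R (∼R (p ²R)) q))) ²R ≈R ⊥R
  modal-⊥R p q = fst≈⊥⇒²R≈⊥R (∧R (■R p) (◆R (∧R (∼R (p ²R)) q))) (begin
    □ (fst p) ∧ ◇ (fst (∼R (p ²R)) ∧ fst q) ≈⟨ H.∧-cong Eq.refl (◇-cong (H.∧-cong fst-∼R-p² Eq.refl)) ⟩
    □ (fst p) ∧ ◇ (- fst p ∧ fst q)         ≈⟨ modal-axiom (fst p) (fst q) ⟩
    ⊥                                       ∎)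
    where
    open ≈-Reasoning setoid

    fst-∼R-p² : fst (∼R (p ²R)) ≈ - fst p
    fst-∼R-p² = Eq.trans (∼R-fst (p ²R)) (²R-snd p)

theorem3 : ∀ {c ℓ₁ ℓ₂ : Level} (M : ModalHeytingAlgebra c ℓ₁ ℓ₂) →
    let open Twist M in
    IsModalNelsonLattice _≈R_ ∨R ∧R *R ⇒R ⊤R ⊥R ■R ◆R
theorem3 M = record
  { isNelsonLattice = twist-isNelsonLattice
  ; ■-cong          = λ (e₁ , e₂) → □-cong e₁ , ◇-cong e₂
  ; ◆-cong          = λ (e₁ , e₂) → ◇-cong e₁ , □-cong e₂
  ; ◆-def           = ◆R≈∼R■R∼R
  ; ■-sq            = λ p q e → from (²R≈⇔fst≈ (■R p) (■R q)) (□-cong (to (²R≈⇔fst≈ p q) e))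
  ; ◆-sq            = λ p q e → from (²R≈⇔fst≈ (◆R p) (◆R q)) (◇-cong (to (²R≈⇔fst≈ p q) e))
  ; modal-⊥         = modal-⊥R
  }
  where
  open ModalHeytingAlgebra M using (□-cong; ◇-cong)
  open Twist M
  open TwistProperties M
  open Equivalence using (to; from)
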